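{- Let $(R_0(n))_{n\ge1}$ be an inhomogeneous linear recurrence sequence (ILRS) of order $d_0\ge1$. Let $M\ge1$ be an integer and for every $j=1,\ldots,M$ let $(R_j(n))_{n\ge1}$ be a reversible and positive ILRS of order $d_j\ge1$. Suppose that $(R_1\circ\cdots\circ R_M)(n)\to\infty$ as $n\to\infty$, where $(S\circ T)(n)=S(T(n))$. Then there exists an integer $m\ge1$ depending only on $R_0,R_1,\ldots,R_M$ such that for every prime number $p$ there is an integer $L$ with $1\le L\le p^{d_0d_1\cdots d_M}$ such that the sequence $\bigl((R_0\circ R_1\circ\cdots\circ R_M)(n)\bmod p\bigr)_{n\ge m}$ is purely $L$-periodic.
   Context: A sequence $(R(n))_{n\ge1}$ is an ILRS of order $d\ge1$ if it is a sequence of integers and there are integers $a_0,\ldots,a_{d-1},b$ with $a_0\ne0$ such that $R(n+d)=a_{d-1}R(n+d-1)+\cdots+a_0R(n)+b$ for every $n\ge1$; it is reversible if this holds with $a_0\in\{ -1,1\}$; positive means $R(n)>0$ for all $n$. $N\bmod p$ denotes the least non-negative residue of $N$ modulo $p$. A sequence $(t(n))_{n\ge n_0}$ is purely $L$-periodic if $t(n)=t(n+L)$ for all $n\ge n_0$. -}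

module Defs where

open import Data.Nat using (ℕ; zero; suc; _≤_; NonZero) renaming (_+_ to _+ℕ_; _*_ to _*ℕ_)
open import Data.Integer using (ℤ; +_; _+_; _*_; -_; ∣_∣; _≥_; _>_; 0ℤ; 1ℤ)
open import Data.Fin using (Fin; zero; suc; toℕ)
open import Data.Product using (Σ; ∃; _×_; _,_)
open import Data.Sum using (_⊎_)
open import Relation.Binary.PropositionalEquality using (_≡_; _≢_)

sumFin : ∀ {d} → (Fin d → ℤ) → ℤ
sumFin {zero}  f = 0ℤ
sumFin {suc d} f = f zero + sumFin (λ i → f (suc i))

prodFin : ∀ {M} → (Fin M → ℕ) → ℕ
prodFin {zero}  f = 1
prodFin {suc M} f = f zero *ℕ prodFin (λ i → f (suc i))

-- A sequence (R(n))_{n≥1} is modelled as R : ℕ → ℤ; only the values at n ≥ 1 matter.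
-- The recurrence with coefficients a (a i = a_i) and constant b holds for all n ≥ 1.
RecHolds : (d : ℕ) → (ℕ → ℤ) → (Fin d → ℤ) → ℤ → Set
RecHolds d R a b = ∀ n → 1 ≤ n → R (n +ℕ d) ≡ sumFin (λ i → a i * R (n +ℕ toℕ i)) + b

IsILRS : (d : ℕ) → (ℕ → ℤ) → Set
IsILRS zero    R = Data.Empty.⊥ where import Data.Empty
IsILRS (suc d) R = Σ (Fin (suc d) → ℤ) λ a → Σ ℤ λ b → (a zero ≢ 0ℤ) × RecHolds (suc d) R a b

IsReversibleILRS : (d : ℕ) → (ℕ → ℤ) → Set
IsReversibleILRS zero    R = Data.Empty.⊥ where import Data.Empty
IsReversibleILRS (suc d) R = Σ (Fin (suc d) → ℤ) λ a → Σ ℤ λ b →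
  ((a zero ≡ 1ℤ) ⊎ (a zero ≡ - 1ℤ)) × RecHolds (suc d) R a b

Positive : (ℕ → ℤ) → Set
Positive R = ∀ n → 1 ≤ n → R n > 0ℤ

-- (R_0 ∘ R_1 ∘ ... ∘ R_{M-1})(n); the argument of each sequence is the (positive)
-- value of the next one, converted to ℕ via ∣_∣ (exact on positive values).
-- For M = 0 this is the identity n ↦ n (not used by the statement, where M ≥ 1).
compose : ∀ {M} → (Fin M → (ℕ → ℤ)) → ℕ → ℤ
compose {zero}  R n = + n
compose {suc M} R n = R zero ∣ compose (λ i → R (suc i)) n ∣

TendsToInfinity : (ℕ → ℤ) → Set
TendsToInfinity t = ∀ (B : ℤ) → ∃ λ N → ∀ n → N ≤ n → t n ≥ B

PurelyPeriodicFrom : ℕ → ℕ → (ℕ → ℕ) → Set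
PurelyPeriodicFrom m L t = ∀ n → m ≤ n → t n ≡ t (n +ℕ L)

module Submission where

-- Modulo N, a window of d consecutive values of an order-d recurrence takes at most N ^ d
-- values, so two of the first N ^ d + 1 windows coincide.  The recurrence carries such a
-- coincidence forward, and when the leading coefficient a₀ can be cancelled modulo N (always
-- for a reversible recurrence; modulo a prime p whenever p ∤ a₀) it also carries it backward,
-- so the sequence is purely periodic modulo N with period at most N ^ d.  If p ∣ a₀ the term
-- a₀ R(n) vanishes modulo p and the order drops.  For a composition S ∘ T, once T(n) is past
-- the start of the periodicity of S modulo N, S(T(n)) modulo N depends only on T(n) modulo the
-- period L₁ of S, so a period of T modulo L₁ is a period of S ∘ T modulo N; nesting the bounds
-- gives L ≤ (N ^ d₁) ^ (d₂ ⋯ d_M).  The growth hypothesis eventually puts the arguments of R₀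
-- past d₀, where its periodicity modulo p starts.

open import Defs
open import Data.Nat
  using (ℕ; zero; suc; _+_; _*_; _∸_; _^_; _≤_; _<_; z≤n; s≤s; s≤s⁻¹; NonZero; >-nonZero; >-nonZero⁻¹)
open import Data.Nat.Properties
  using (≤-refl; ≤-reflexive; ≤-trans; ≤-<-trans; ≤-total; <⇒≤; <⇒≱; ⊔-lub; m≤m+n; n≤1+n; n<1+n; m≤n*m;
         m<n⇒m<1+n; m≤n⇒m<n∨m≡n; m<n⇒0<n∸m; m∸n≤m; m+[n∸m]≡n; +-identityʳ; +-suc; +-assoc; +-comm;
         *-identityʳ; ^-monoˡ-≤; ^-*-assoc)
open import Data.Nat.DivMod using (m<n⇒m%n≡m; [m+n]%n≡m%n)
open import Data.Nat.Divisibility using (divides; ∣⇒≤) renaming (_∣_ to _∣ℕ_)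
open import Data.Nat.Primality using (Prime; euclidsLemma)
open import Data.Integer using (ℤ; +_; 0ℤ; 1ℤ; -1ℤ; -_; ∣_∣; _≥_; _>_; +≤+; +<+)
  renaming (_+_ to _+ℤ_; _*_ to _*ℤ_; _-_ to _-ℤ_)
open import Data.Integer.Properties
  using (+-inverseʳ; +-minus-telescope; +-injective; i-j≡0⇒i≡j; ∣i∣≡0⇒i≡0; abs-*; [+m]-[+n]≡m⊖n;
         ∣m⊝n∣≤m⊔n; ∣⊖∣-≤)
  renaming (+-identityˡ to +ℤ-identityˡ; +-identityʳ to +ℤ-identityʳ; *-identityˡ to *ℤ-identityˡ;
            +-assoc to +ℤ-assoc)
open import Data.Integer.DivMod using (_%ℕ_; _/ℕ_; a≡a%ℕn+[a/ℕn]*n; n%ℕd<d)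
open import Data.Integer.Divisibility.Signed
  using (_∣_; divides; _∣?_; ∣ᵤ⇒∣; ∣⇒∣ᵤ; ∣m∣n⇒∣m+n; ∣m⇒∣-m; ∣m⇒∣m*n; ∣n⇒∣m*n; ∣m+n∣n⇒∣m)
open import Data.Integer.Tactic.RingSolver using (solve-∀)
open import Data.Fin using (Fin; zero; suc; toℕ; fromℕ<; funToFin; finToFun)
open import Data.Fin.Properties using (pigeonhole; toℕ<n; toℕ≤pred[n]; toℕ-fromℕ<; finToFun-funToFin)
open import Data.Product using (Σ; _×_; _,_; proj₁; proj₂)
open import Data.Sum using (_⊎_; inj₁; inj₂)
open import Data.Empty using (⊥-elim)
open import Function using (_∘_)
open import Level using (0ℓ)
open import Relation.Nullary using (¬_; yes; no)
open import Relation.Binary using (IsEquivalence; Setoid)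
open import Relation.Binary.PropositionalEquality
  using (_≡_; refl; sym; trans; cong; cong₂; subst; subst₂; module ≡-Reasoning)
import Relation.Binary.Reasoning.Setoid as SetoidReasoning

infix 4 _≡_mod_

-- A record rather than a synonym for  + N ∣ x -ℤ y , so that x and y are inferable from it.
record _≡_mod_ (x y : ℤ) (N : ℕ) : Set where
  constructor from-∣
  field to-∣ : + N ∣ x -ℤ y

private
  neg-minus : ∀ x y → - (x -ℤ y) ≡ y -ℤ x
  neg-minus = solve-∀

  minus-+ : ∀ x y u v → (x -ℤ y) +ℤ (u -ℤ v) ≡ (x +ℤ u) -ℤ (y +ℤ v)
  minus-+ = solve-∀

  *-distribˡ-minus : ∀ c x y → c *ℤ (x -ℤ y) ≡ c *ℤ x -ℤ c *ℤ y
  *-distribˡ-minus = solve-∀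

  -1*-1*i≡i : ∀ x → -1ℤ *ℤ (-1ℤ *ℤ x) ≡ x
  -1*-1*i≡i = solve-∀

module _ {N : ℕ} where

  mod-refl : ∀ {x} → x ≡ x mod N
  mod-refl {x} = from-∣ (divides 0ℤ (+-inverseʳ x))

  mod-reflexive : ∀ {x y} → x ≡ y → x ≡ y mod N
  mod-reflexive refl = mod-refl

  mod-sym : ∀ {x y} → x ≡ y mod N → y ≡ x mod N
  mod-sym {x} {y} (from-∣ N∣x-y) = from-∣ (subst (+ N ∣_) (neg-minus x y) (∣m⇒∣-m N∣x-y))

  mod-trans : ∀ {x y z} → x ≡ y mod N → y ≡ z mod N → x ≡ z mod N
  mod-trans {x} {y} {z} (from-∣ N∣x-y) (from-∣ N∣y-z) =
    from-∣ (subst (+ N ∣_) (+-minus-telescope x y z) (∣m∣n⇒∣m+n N∣x-y N∣y-z))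

  +-cong-mod : ∀ {x y u v} → x ≡ y mod N → u ≡ v mod N → x +ℤ u ≡ y +ℤ v mod N
  +-cong-mod {x} {y} {u} {v} (from-∣ N∣x-y) (from-∣ N∣u-v) =
    from-∣ (subst (+ N ∣_) (minus-+ x y u v) (∣m∣n⇒∣m+n N∣x-y N∣u-v))

  +-cancelʳ-mod : ∀ {x y u v} → x +ℤ u ≡ y +ℤ v mod N → u ≡ v mod N → x ≡ y mod N
  +-cancelʳ-mod {x} {y} {u} {v} (from-∣ N∣sum) (from-∣ N∣u-v) =
    from-∣ (∣m+n∣n⇒∣m (subst (+ N ∣_) (sym (minus-+ x y u v)) N∣sum) N∣u-v)

  *-congˡ-mod : ∀ c {x y} → x ≡ y mod N → c *ℤ x ≡ c *ℤ y mod N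
  *-congˡ-mod c {x} {y} (from-∣ N∣x-y) = from-∣ (subst (+ N ∣_) (*-distribˡ-minus c x y) (∣n⇒∣m*n c N∣x-y))

  ∣⇒≡0-mod : ∀ {x} → + N ∣ x → x ≡ 0ℤ mod N
  ∣⇒≡0-mod {x} N∣x = from-∣ (subst (+ N ∣_) (sym (+ℤ-identityʳ x)) N∣x)

  sumFin-cong-mod : ∀ {d} {f g : Fin d → ℤ} → (∀ i → f i ≡ g i mod N) → sumFin f ≡ sumFin g mod N
  sumFin-cong-mod {zero}  f≡g = mod-refl
  sumFin-cong-mod {suc d} f≡g = +-cong-mod (f≡g zero) (sumFin-cong-mod (f≡g ∘ suc))

mod-isEquivalence : ∀ N → IsEquivalence (_≡_mod N)
mod-isEquivalence N = record { refl = mod-refl ; sym = mod-sym ; trans = mod-trans }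

mod-setoid : ℕ → Setoid 0ℓ 0ℓ
mod-setoid N = record { isEquivalence = mod-isEquivalence N }

module ModReasoning (N : ℕ) = SetoidReasoning (mod-setoid N)

module _ (N : ℕ) .{{_ : NonZero N}} where

  %ℕ≡⇒mod : ∀ {x y} → x %ℕ N ≡ y %ℕ N → x ≡ y mod N
  %ℕ≡⇒mod {x} {y} same = from-∣ (divides (x /ℕ N -ℤ y /ℕ N) (begin
    x -ℤ y
      ≡⟨ cong₂ _-ℤ_ (a≡a%ℕn+[a/ℕn]*n x N) (a≡a%ℕn+[a/ℕn]*n y N) ⟩
    (+ (x %ℕ N) +ℤ x /ℕ N *ℤ + N) -ℤ (+ (y %ℕ N) +ℤ y /ℕ N *ℤ + N)
      ≡⟨ cong (λ r → (+ r +ℤ x /ℕ N *ℤ + N) -ℤ (+ (y %ℕ N) +ℤ y /ℕ N *ℤ + N)) same ⟩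
    (+ (y %ℕ N) +ℤ x /ℕ N *ℤ + N) -ℤ (+ (y %ℕ N) +ℤ y /ℕ N *ℤ + N)
      ≡⟨ cancel-remainder (+ (y %ℕ N)) (x /ℕ N) (y /ℕ N) (+ N) ⟩
    (x /ℕ N -ℤ y /ℕ N) *ℤ + N ∎))
    where
    open ≡-Reasoning
    cancel-remainder : ∀ r q q′ n → (r +ℤ q *ℤ n) -ℤ (r +ℤ q′ *ℤ n) ≡ (q -ℤ q′) *ℤ n
    cancel-remainder = solve-∀

  residue-mod : ∀ x → + (x %ℕ N) ≡ x mod N
  residue-mod x = %ℕ≡⇒mod (m<n⇒m%n≡m (n%ℕd<d x N))

  residue-unique : ∀ {m n} → m < N → n < N → + m ≡ + n mod N → m ≡ n
  residue-unique {m} {n} m<N n<N (from-∣ N∣m-n) =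
    +-injective (i-j≡0⇒i≡j (+ m) (+ n) (∣i∣≡0⇒i≡0 (multiple-below-modulus (∣⇒∣ᵤ N∣m-n) distance<N)))
    where
    distance<N : ∣ + m -ℤ + n ∣ < N
    distance<N = subst (_< N) (cong ∣_∣ (sym ([+m]-[+n]≡m⊖n m n))) (≤-<-trans (∣m⊝n∣≤m⊔n m n) (⊔-lub m<N n<N))
    multiple-below-modulus : ∀ {k} → N ∣ℕ k → k < N → k ≡ 0
    multiple-below-modulus {zero}  _   _   = refl
    multiple-below-modulus {suc k} N∣k k<N = ⊥-elim (<⇒≱ k<N (∣⇒≤ N∣k))

  mod⇒%ℕ≡ : ∀ {x y} → x ≡ y mod N → x %ℕ N ≡ y %ℕ N
  mod⇒%ℕ≡ {x} {y} x≡y = residue-unique (n%ℕd<d x N) (n%ℕd<d y N)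
    (mod-trans (residue-mod x) (mod-trans x≡y (mod-sym (residue-mod y))))

  residue : ℤ → Fin N
  residue x = fromℕ< (n%ℕd<d x N)

  residue-injective : ∀ {x y} → residue x ≡ residue y → x ≡ y mod N
  residue-injective {x} {y} same =
    %ℕ≡⇒mod (trans (sym (toℕ-fromℕ< (n%ℕd<d x N))) (trans (cong toℕ same) (toℕ-fromℕ< (n%ℕd<d y N))))

funToFin-injective : ∀ {m n} (f g : Fin m → Fin n) → funToFin f ≡ funToFin g → ∀ i → f i ≡ g i
funToFin-injective f g same i =
  trans (sym (finToFun-funToFin f i)) (trans (cong (λ c → finToFun c i) same) (finToFun-funToFin g i))

Cancellable : ℕ → ℤ → Set
Cancellable N c = ∀ {x y} → c *ℤ x ≡ c *ℤ y mod N → x ≡ y mod N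

unit-cancellable : ∀ {N c} → c ≡ 1ℤ ⊎ c ≡ -1ℤ → Cancellable N c
unit-cancellable (inj₁ refl) {x} {y} = subst₂ (_≡_mod _) (*ℤ-identityˡ x) (*ℤ-identityˡ y)
unit-cancellable (inj₂ refl) {x} {y} = subst₂ (_≡_mod _) (-1*-1*i≡i x) (-1*-1*i≡i y) ∘ *-congˡ-mod -1ℤ

prime-cancellable : ∀ {p c} → Prime p → ¬ (+ p ∣ c) → Cancellable p c
prime-cancellable {p} {c} p-prime p∤c {x} {y} (from-∣ p∣cx-cy)
  with euclidsLemma ∣ c ∣ ∣ x -ℤ y ∣ p-prime
         (subst (p ∣ℕ_) (abs-* c (x -ℤ y)) (∣⇒∣ᵤ (subst (+ p ∣_) (sym (*-distribˡ-minus c x y)) p∣cx-cy)))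
... | inj₁ p∣c   = ⊥-elim (p∤c (∣ᵤ⇒∣ p∣c))
... | inj₂ p∣x-y = from-∣ (∣ᵤ⇒∣ p∣x-y)

RecurrenceMod : (N d : ℕ) → (ℕ → ℤ) → ℕ → (Fin d → ℤ) → ℤ → Set
RecurrenceMod N d s m a b = ∀ n → m ≤ n → s (n + d) ≡ sumFin (λ i → a i *ℤ s (n + toℕ i)) +ℤ b mod N

PeriodicMod : (N m L : ℕ) → (ℕ → ℤ) → Set
PeriodicMod N m L s = ∀ n → m ≤ n → s n ≡ s (n + L) mod N

HasPeriodMod : (N m B : ℕ) → (ℕ → ℤ) → Set
HasPeriodMod N m B s = Σ ℕ λ L → 1 ≤ L × L ≤ B × PeriodicMod N m L s

HasPeriodMod-weaken : ∀ {N m m′ B B′ s} → m ≤ m′ → B ≤ B′ → HasPeriodMod N m B s → HasPeriodMod N m′ B′ s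
HasPeriodMod-weaken m≤m′ B≤B′ (L , 1≤L , L≤B , periodic) =
  L , 1≤L , ≤-trans L≤B B≤B′ , λ n m′≤n → periodic n (≤-trans m≤m′ m′≤n)

module CancellableRecurrence {N e m b} .{{_ : NonZero N}} {s : ℕ → ℤ} {a : Fin (suc e) → ℤ}
  (cancel : Cancellable N (a zero)) (rec : RecurrenceMod N (suc e) s m a b) where

  WindowsAgree : ℕ → ℕ → Set
  WindowsAgree L n = ∀ k → k < suc e → s (n + k) ≡ s (n + L + k) mod N

  private
    shift⁺ : ∀ {n n′ k} → s (n + suc k) ≡ s (n′ + suc k) mod N → s (suc n + k) ≡ s (suc n′ + k) mod N
    shift⁺ {n} {n′} {k} = subst₂ (λ u v → s u ≡ s v mod N) (+-suc n k) (+-suc n′ k)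

    shift⁻ : ∀ {n n′ k} → s (suc n + k) ≡ s (suc n′ + k) mod N → s (n + suc k) ≡ s (n′ + suc k) mod N
    shift⁻ {n} {n′} {k} = subst₂ (λ u v → s u ≡ s v mod N) (sym (+-suc n k)) (sym (+-suc n′ k))

  next-agrees : ∀ {L n} → m ≤ n → WindowsAgree L n → s (n + suc e) ≡ s (n + L + suc e) mod N
  next-agrees {L} {n} m≤n agree = begin
    s (n + suc e)                                    ≈⟨ rec n m≤n ⟩
    sumFin (λ i → a i *ℤ s (n + toℕ i)) +ℤ b          ≈⟨ +-cong-mod (sumFin-cong-mod window) mod-refl ⟩
    sumFin (λ i → a i *ℤ s (n + L + toℕ i)) +ℤ b      ≈⟨ rec (n + L) (≤-trans m≤n (m≤m+n n L)) ⟨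
    s (n + L + suc e)                                ∎
    where
    open ModReasoning N
    window : ∀ i → a i *ℤ s (n + toℕ i) ≡ a i *ℤ s (n + L + toℕ i) mod N
    window i = *-congˡ-mod (a i) (agree (toℕ i) (toℕ<n i))

  -- Cancelling a₀ is what lets the first term be recovered from the next d terms.
  first-agrees : ∀ {L n} → m ≤ n → WindowsAgree L (suc n) → s (n + 0) ≡ s (n + L + 0) mod N
  first-agrees {L} {n} m≤n agree = cancel (+-cancelʳ-mod split-agrees rest-agrees)
    where
    rest : ℕ → ℤ
    rest n = sumFin (λ i → a (suc i) *ℤ s (n + suc (toℕ i))) +ℤ b
    split : ∀ n → m ≤ n → a zero *ℤ s (n + 0) +ℤ rest n ≡ s (n + suc e) mod N
    split n m≤n = mod-sym (mod-trans (rec n m≤n) (mod-reflexive (+ℤ-assoc (a zero *ℤ s (n + 0)) _ b)))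
    rest-agrees : rest n ≡ rest (n + L) mod N
    rest-agrees = +-cong-mod (sumFin-cong-mod λ i →
      *-congˡ-mod (a (suc i)) (shift⁻ (agree (toℕ i) (m<n⇒m<1+n (toℕ<n i))))) mod-refl
    split-agrees : a zero *ℤ s (n + 0) +ℤ rest n ≡ a zero *ℤ s (n + L + 0) +ℤ rest (n + L) mod N
    split-agrees = begin
      a zero *ℤ s (n + 0) +ℤ rest n            ≈⟨ split n m≤n ⟩
      s (n + suc e)                           ≈⟨ shift⁻ (agree e (n<1+n e)) ⟩
      s (n + L + suc e)                       ≈⟨ split (n + L) (≤-trans m≤n (m≤m+n n L)) ⟨
      a zero *ℤ s (n + L + 0) +ℤ rest (n + L)  ∎
      where open ModReasoning N

  agree-suc : ∀ {L n} → m ≤ n → WindowsAgree L n → WindowsAgree L (suc n)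
  agree-suc m≤n agree k k<d with m≤n⇒m<n∨m≡n (s≤s⁻¹ k<d)
  ... | inj₁ k<e  = shift⁺ (agree (suc k) (s≤s k<e))
  ... | inj₂ refl = shift⁺ (next-agrees m≤n agree)

  agree-pred : ∀ {L n} → m ≤ n → WindowsAgree L (suc n) → WindowsAgree L n
  agree-pred m≤n agree zero    _         = first-agrees m≤n agree
  agree-pred m≤n agree (suc k) (s≤s k<e) = shift⁻ (agree k (m<n⇒m<1+n k<e))

  agree-+ : ∀ {L n} → m ≤ n → WindowsAgree L n → ∀ t → WindowsAgree L (n + t)
  agree-+ {L} {n} m≤n agree zero    = subst (WindowsAgree L) (sym (+-identityʳ n)) agree
  agree-+ {L} {n} m≤n agree (suc t) =
    subst (WindowsAgree L) (sym (+-suc n t)) (agree-suc (≤-trans m≤n (m≤m+n n t)) (agree-+ m≤n agree t))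

  agree-+⁻¹ : ∀ {L n} → m ≤ n → ∀ t → WindowsAgree L (n + t) → WindowsAgree L n
  agree-+⁻¹ {L} {n} m≤n zero    agree = subst (WindowsAgree L) (+-identityʳ n) agree
  agree-+⁻¹ {L} {n} m≤n (suc t) agree =
    agree-+⁻¹ m≤n t (agree-pred (≤-trans m≤n (m≤m+n n t)) (subst (WindowsAgree L) (+-suc n t) agree))

  agree-everywhere : ∀ {L i} → m ≤ i → WindowsAgree L i → ∀ n → m ≤ n → WindowsAgree L n
  agree-everywhere {L} {i} m≤i agree n m≤n with ≤-total i n
  ... | inj₁ i≤n = subst (WindowsAgree L) (m+[n∸m]≡n i≤n) (agree-+ m≤i agree (n ∸ i))
  ... | inj₂ n≤i = agree-+⁻¹ m≤n (i ∸ n) (subst (WindowsAgree L) (sym (m+[n∸m]≡n n≤i)) agree)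

  residues : ℕ → Fin (suc e) → Fin N
  residues n k = residue N (s (n + toℕ k))

  window : ℕ → Fin (N ^ suc e)
  window n = funToFin (residues n)

  window-injective : ∀ {n n′} → window n ≡ window n′ → ∀ k → k < suc e → s (n + k) ≡ s (n′ + k) mod N
  window-injective {n} {n′} same k k<d = subst (λ j → s (n + j) ≡ s (n′ + j) mod N) (toℕ-fromℕ< k<d)
    (residue-injective N (funToFin-injective (residues n) (residues n′) same (fromℕ< k<d)))

  periodic : HasPeriodMod N m (N ^ suc e) s
  periodic with pigeonhole (n<1+n (N ^ suc e)) (λ i → window (m + toℕ i))
  ... | i , j , i<j , same = L , m<n⇒0<n∸m i<j , ≤-trans (m∸n≤m (toℕ j) (toℕ i)) (toℕ≤pred[n] j) , periodicity
    where
    L = toℕ j ∸ toℕ i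
    j≡i+L : m + toℕ j ≡ m + toℕ i + L
    j≡i+L = trans (cong (_+_ m) (sym (m+[n∸m]≡n (<⇒≤ i<j)))) (sym (+-assoc m (toℕ i) L))
    start : WindowsAgree L (m + toℕ i)
    start = subst (λ n → ∀ k → k < suc e → s (m + toℕ i + k) ≡ s (n + k) mod N) j≡i+L (window-injective same)
    periodicity : PeriodicMod N m L s
    periodicity n m≤n = subst₂ (λ u v → s u ≡ s v mod N) (+-identityʳ n) (+-identityʳ (n + L))
      (agree-everywhere (m≤m+n m (toℕ i)) start n m≤n 0 (s≤s z≤n))

recurrence-drop-leading : ∀ {N e s m a b} → + N ∣ a zero → RecurrenceMod N (suc e) s m a b →
                          RecurrenceMod N e s (suc m) (a ∘ suc) b
recurrence-drop-leading {N} {e} {s} {a = a} {b} N∣a₀ rec (suc n) (s≤s m≤n) = begin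
  s (suc n + e)                                        ≡⟨ cong s (sym (+-suc n e)) ⟩
  s (n + suc e)                                        ≈⟨ rec n m≤n ⟩
  a zero *ℤ s (n + 0) +ℤ rest +ℤ b                      ≈⟨ +-cong-mod (+-cong-mod leading≡0 mod-refl) mod-refl ⟩
  0ℤ +ℤ rest +ℤ b                                       ≡⟨ cong (_+ℤ b) (+ℤ-identityˡ rest) ⟩
  rest +ℤ b                                             ≈⟨ +-cong-mod (sumFin-cong-mod shifted) mod-refl ⟩
  sumFin (λ i → a (suc i) *ℤ s (suc n + toℕ i)) +ℤ b    ∎
  where
  open ModReasoning N
  leading≡0 : a zero *ℤ s (n + 0) ≡ 0ℤ mod N
  leading≡0 = ∣⇒≡0-mod (∣m⇒∣m*n (s (n + 0)) N∣a₀)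
  rest : ℤ
  rest = sumFin (λ i → a (suc i) *ℤ s (n + suc (toℕ i)))
  shifted : ∀ i → a (suc i) *ℤ s (n + suc (toℕ i)) ≡ a (suc i) *ℤ s (suc n + toℕ i) mod N
  shifted i = mod-reflexive (cong (λ k → a (suc i) *ℤ s k) (+-suc n (toℕ i)))

zero-order-periodic : ∀ {N s m a b} → RecurrenceMod N 0 s m a b → PeriodicMod N m 1 s
zero-order-periodic {N} {s} {b = b} rec n m≤n = begin
  s n                ≡⟨ cong s (sym (+-identityʳ n)) ⟩
  s (n + 0)          ≈⟨ rec n m≤n ⟩
  0ℤ +ℤ b            ≈⟨ rec (n + 1) (≤-trans m≤n (m≤m+n n 1)) ⟨
  s (n + 1 + 0)      ≡⟨ cong s (+-identityʳ (n + 1)) ⟩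
  s (n + 1)          ∎
  where open ModReasoning N

recurrence-HasPeriodMod-prime : ∀ {p} .{{_ : NonZero p}} → Prime p → ∀ d {s m a b} →
                                RecurrenceMod p d s m a b → HasPeriodMod p (m + d) (p ^ d) s
recurrence-HasPeriodMod-prime p-prime zero {s} {m} {a} {b} rec =
  1 , ≤-refl , ≤-refl , λ n m+0≤n → zero-order-periodic {s = s} {a = a} {b = b} rec n (≤-trans (m≤m+n m 0) m+0≤n)
recurrence-HasPeriodMod-prime {p} p-prime (suc e) {s} {m} {a} {b} rec with + p ∣? a zero
... | no  p∤a₀ = HasPeriodMod-weaken (m≤m+n m (suc e)) ≤-refl
                   (CancellableRecurrence.periodic {b = b} {s = s} {a = a} (prime-cancellable p-prime p∤a₀) rec)
... | yes p∣a₀ = HasPeriodMod-weaken (≤-reflexive (sym (+-suc m e))) (m≤n*m (p ^ e) p)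
                   (recurrence-HasPeriodMod-prime p-prime e {s} {suc m} {a ∘ suc} {b}
                     (recurrence-drop-leading {e = e} {s} {m} {a} {b} p∣a₀ rec))

periodic-mod-iterate : ∀ {N m L s n} → PeriodicMod N m L s → m ≤ n → ∀ t → s n ≡ s (n + t * L) mod N
periodic-mod-iterate {s = s} {n} periodic m≤n zero = mod-reflexive (cong s (sym (+-identityʳ n)))
periodic-mod-iterate {N} {L = L} {s} {n} periodic m≤n (suc t) = begin
  s n                  ≈⟨ periodic-mod-iterate periodic m≤n t ⟩
  s (n + t * L)        ≈⟨ periodic (n + t * L) (≤-trans m≤n (m≤m+n n (t * L))) ⟩
  s (n + t * L + L)    ≡⟨ cong s (trans (+-assoc n (t * L) L) (cong (_+_ n) (+-comm (t * L) L))) ⟩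
  s (n + suc t * L)    ∎
  where open ModReasoning N

+-mod⇒∣∸ : ∀ {L x y} → x ≤ y → + x ≡ + y mod L → L ∣ℕ y ∸ x
+-mod⇒∣∸ {L} {x} {y} x≤y (from-∣ L∣x-y) =
  subst (L ∣ℕ_) (trans (cong ∣_∣ ([+m]-[+n]≡m⊖n x y)) (∣⊖∣-≤ x≤y)) (∣⇒∣ᵤ L∣x-y)

periodic-mod-∣∸ : ∀ {N m L s x y} → PeriodicMod N m L s → m ≤ x → x ≤ y → L ∣ℕ y ∸ x → s x ≡ s y mod N
periodic-mod-∣∸ {N} {s = s} {x} {y} periodic m≤x x≤y (divides t y∸x≡tL) =
  subst (λ z → s x ≡ s z mod N) (trans (cong (_+_ x) (sym y∸x≡tL)) (m+[n∸m]≡n x≤y))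
    (periodic-mod-iterate periodic m≤x t)

periodic-mod-cong : ∀ {N m L s x y} → PeriodicMod N m L s → m ≤ x → m ≤ y → + x ≡ + y mod L → s x ≡ s y mod N
periodic-mod-cong {x = x} {y} periodic m≤x m≤y x≡y with ≤-total x y
... | inj₁ x≤y = periodic-mod-∣∸ periodic m≤x x≤y (+-mod⇒∣∸ x≤y x≡y)
... | inj₂ y≤x = mod-sym (periodic-mod-∣∸ periodic m≤y y≤x (+-mod⇒∣∸ y≤x (mod-sym x≡y)))

i≥+m⇒+∣i∣≡i×m≤∣i∣ : ∀ {m i} → i ≥ + m → + ∣ i ∣ ≡ i × m ≤ ∣ i ∣
i≥+m⇒+∣i∣≡i×m≤∣i∣ (+≤+ m≤n) = refl , m≤n

periodic-mod-compose : ∀ {N m m′ L₁ L s t} → PeriodicMod N m L₁ s → PeriodicMod L₁ m′ L t →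
                       (∀ n → m′ ≤ n → t n ≥ + m) → PeriodicMod N m′ L (λ n → s ∣ t n ∣)
periodic-mod-compose {L₁ = L₁} {L} periodic-s periodic-t large n m′≤n =
  periodic-mod-cong periodic-s (proj₂ tₙ) (proj₂ tₙ₊L)
    (subst₂ (_≡_mod L₁) (sym (proj₁ tₙ)) (sym (proj₁ tₙ₊L)) (periodic-t n m′≤n))
  where
  tₙ   = i≥+m⇒+∣i∣≡i×m≤∣i∣ (large n m′≤n)
  tₙ₊L = i≥+m⇒+∣i∣≡i×m≤∣i∣ (large (n + L) (≤-trans m′≤n (m≤m+n n L)))

HasPeriodMod-∘ : ∀ {N m m′ j k s t} .{{_ : NonZero N}} →
                 HasPeriodMod N m (N ^ j) s → (∀ L₁ .{{_ : NonZero L₁}} → HasPeriodMod L₁ m′ (L₁ ^ k) t) →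
                 (∀ n → m′ ≤ n → t n ≥ + m) → HasPeriodMod N m′ (N ^ (j * k)) (λ n → s ∣ t n ∣)
HasPeriodMod-∘ {N} {j = j} {k} (L₁ , 1≤L₁ , L₁≤Nʲ , periodic-s) period-t large
  with period-t L₁ {{>-nonZero 1≤L₁}}
... | L , 1≤L , L≤L₁ᵏ , periodic-t =
  L , 1≤L , ≤-trans L≤L₁ᵏ (≤-trans (^-monoˡ-≤ k L₁≤Nʲ) (≤-reflexive (^-*-assoc N j k))) ,
  periodic-mod-compose periodic-s periodic-t large

reversible-HasPeriodMod : ∀ {d R} → IsReversibleILRS d R → ∀ N .{{_ : NonZero N}} → HasPeriodMod N 1 (N ^ d) R
reversible-HasPeriodMod {suc e} {R} (a , b , unit , rec) N =
  CancellableRecurrence.periodic {b = b} {s = R} {a = a} (unit-cancellable unit)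
    (λ n 1≤n → mod-reflexive (rec n 1≤n))

compose-≥1 : ∀ {M} {R : Fin M → ℕ → ℤ} → (∀ j → Positive (R j)) → ∀ n → 1 ≤ n → compose R n ≥ 1ℤ
compose-≥1 {zero}  positive n 1≤n = +≤+ 1≤n
compose-≥1 {suc M} positive n 1≤n =
  >0⇒≥1 (positive zero _ (proj₂ (i≥+m⇒+∣i∣≡i×m≤∣i∣ (compose-≥1 (positive ∘ suc) n 1≤n))))
  where
  >0⇒≥1 : ∀ {i} → i > 0ℤ → i ≥ 1ℤ
  >0⇒≥1 (+<+ 0<n) = +≤+ 0<n

compose-HasPeriodMod : ∀ {M} {R : Fin M → ℕ → ℤ} {d : Fin M → ℕ} → (∀ j → IsReversibleILRS (d j) (R j)) →
                   (∀ j → Positive (R j)) → ∀ N .{{_ : NonZero N}} → HasPeriodMod N 1 (N ^ prodFin d) (compose R)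
compose-HasPeriodMod {zero} _ _ N =
  N , >-nonZero⁻¹ N , ≤-reflexive (sym (*-identityʳ N)) , λ n _ → %ℕ≡⇒mod N (sym ([m+n]%n≡m%n n N))
compose-HasPeriodMod {suc M} {d = d} reversible positive N =
  HasPeriodMod-∘ {j = d zero} {k = prodFin (d ∘ suc)} (reversible-HasPeriodMod (reversible zero) N)
    (compose-HasPeriodMod (reversible ∘ suc) (positive ∘ suc)) (compose-≥1 (positive ∘ suc))

HasPeriodMod⇒PurelyPeriodic-%ℕ : ∀ {p m B t} .{{_ : NonZero p}} → HasPeriodMod p m B t →
              Σ ℕ λ L → 1 ≤ L × L ≤ B × PurelyPeriodicFrom m L (λ n → t n %ℕ p)
HasPeriodMod⇒PurelyPeriodic-%ℕ {p} (L , 1≤L , L≤B , periodic) =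
  L , 1≤L , L≤B , λ n m≤n → mod⇒%ℕ≡ p (periodic n m≤n)

lemma2p3 : (R₀ : ℕ → ℤ) (d₀ : ℕ) → 1 ≤ d₀ → IsILRS d₀ R₀ →
    (M : ℕ) → 1 ≤ M →
    (R : Fin M → (ℕ → ℤ)) (d : Fin M → ℕ) →
    (∀ j → 1 ≤ d j) → (∀ j → IsReversibleILRS (d j) (R j)) → (∀ j → Positive (R j)) →
    TendsToInfinity (compose R) →
    Σ ℕ λ m → 1 ≤ m ×
      (∀ (p : ℕ) .{{_ : NonZero p}} → Prime p →
        Σ ℕ λ L → 1 ≤ L × L ≤ p ^ (d₀ * prodFin d) ×
          PurelyPeriodicFrom m L (λ n → R₀ ∣ compose R n ∣ %ℕ p))
lemma2p3 R₀ (suc e) _ (a , b , _ , rec₀) _ _ _ d _ reversible positive →∞ with →∞ (+ suc (suc e))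
... | N₀ , large = suc N₀ , s≤s z≤n , λ p p-prime → HasPeriodMod⇒PurelyPeriodic-%ℕ
  (HasPeriodMod-∘ {j = suc e} {k = prodFin d}
    (recurrence-HasPeriodMod-prime p-prime (suc e) {R₀} {1} {a} {b} (λ n 1≤n → mod-reflexive (rec₀ n 1≤n)))
    (λ L₁ → HasPeriodMod-weaken (s≤s z≤n) ≤-refl (compose-HasPeriodMod reversible positive L₁))
    (λ n N₀<n → large n (≤-trans (n≤1+n N₀) N₀<n)))
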